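{- If $\psi$ is an arrow-free type, then $\mathrm{SN}\subseteq[\![\psi]\!]$.
   Context: Calculus $\lambda^{::}_{\mathtt{catch}}$. Types: $\sigma,\tau,\rho ::= \mathtt{unit} \mid \mathtt{list}\,\tau \mid \sigma\to\tau$; a type is arrow-free if it contains no $\to$. Terms: $t,r,s ::= x \mid () \mid \mathtt{nil} \mid (::) \mid \mathtt{lrec} \mid \lambda x.r \mid t\,s \mid \mathtt{catch}\,\alpha\,t \mid \mathtt{throw}\,\alpha\,t$ ($x$ variables, $\alpha,\beta$ continuation variables; application left-associative; $t::r$ abbreviates $(::)\,t\,r$). $\mathrm{FCV}$ = free continuation variables, $t[x:=r]$ capture-avoiding substitution. Values: $v,w ::= x \mid () \mid \mathtt{nil} \mid (::) \mid (::)\,v \mid (::)\,v\,w \mid \mathtt{lrec} \mid \mathtt{lrec}\,v \mid \mathtt{lrec}\,v\,w \mid \lambda x.r$. Contexts $E ::= \Box\,t \mid v\,\Box \mid \mathtt{throw}\,\alpha\,\Box$. Reduction $\to$ is the compatible closure of: $(\lambda x.t)\,v\to t[x:=v]$; $E[\mathtt{throw}\,\alpha\,t]\to\mathtt{throw}\,\alpha\,t$; $\mathtt{catch}\,\alpha\,(\mathtt{throw}\,\alpha\,t)\to\mathtt{catch}\,\alpha\,t$; $\mathtt{catch}\,\alpha\,(\mathtt{throw}\,\beta\,v)\to\mathtt{throw}\,\beta\,v$ if $\alpha\notin\{\beta\}\cup\mathrm{FCV}(v)$; $\mathtt{catch}\,\alpha\,v\to v$ if $\alpha\notin\mathrm{FCV}(v)$;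 $\mathtt{lrec}\,v_r\,v_s\,\mathtt{nil}\to v_r$; $\mathtt{lrec}\,v_r\,v_s\,(v_h::v_t)\to v_s\,v_h\,v_t\,(\mathtt{lrec}\,v_r\,v_s\,v_t)$; $\twoheadrightarrow$ is its reflexive-transitive closure. $\mathrm{SN}$ is the set of terms $t$ for which the lengths of all reduction sequences starting at $t$ are bounded. For a set of terms $S$, the set $L(S)$ is inductively defined by: $t\in L(S)$ if for all values $v,w$ with $t\twoheadrightarrow v::w$ we have $v\in S$ and $w\in L(S)$. The interpretation of types: $[\![\mathtt{unit}]\!]=\mathrm{SN}$, $[\![\mathtt{list}\,\sigma]\!]=\mathrm{SN}\cap L([\![\sigma]\!])$, $[\![\sigma\to\tau]\!]=\{t\mid \forall s\in[\![\sigma]\!],\ ts\in[\![\tau]\!]\}$. -}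

module Defs where

open import Data.Nat using (ℕ; zero; suc; _≤_)
open import Data.Product using (Σ; _×_)

data Ty : Set where
  unit : Ty
  list : Ty → Ty
  _⇒_  : Ty → Ty → Ty

data ArrowFree : Ty → Set where
  af-unit : ArrowFree unit
  af-list : ∀ {τ} → ArrowFree τ → ArrowFree (list τ)

-- Terms (de Bruijn indices for both term variables and continuation
-- variables; `catch` binds continuation index 0, `lam` binds term index 0)
data Tm : Set where
  var   : ℕ → Tm
  unit  : Tm
  nil   : Tm
  cons  : Tm
  lrec  : Tm
  lam   : Tm → Tm
  app   : Tm → Tm → Tm
  catch : Tm → Tm
  throw : ℕ → Tm → Tm

ext : (ℕ → ℕ) → ℕ → ℕ
ext ρ zero    = zero
ext ρ (suc n) = suc (ρ n)

ren : (ℕ → ℕ) → Tm → Tm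
ren ρ (var x)     = var (ρ x)
ren ρ unit        = unit
ren ρ nil         = nil
ren ρ cons        = cons
ren ρ lrec        = lrec
ren ρ (lam t)     = lam (ren (ext ρ) t)
ren ρ (app t s)   = app (ren ρ t) (ren ρ s)
ren ρ (catch t)   = catch (ren ρ t)
ren ρ (throw α t) = throw α (ren ρ t)

cren : (ℕ → ℕ) → Tm → Tm
cren ρ (var x)     = var x
cren ρ unit        = unit
cren ρ nil         = nil
cren ρ cons        = cons
cren ρ lrec        = lrec
cren ρ (lam t)     = lam (cren ρ t)
cren ρ (app t s)   = app (cren ρ t) (cren ρ s)
cren ρ (catch t)   = catch (cren (ext ρ) t)
cren ρ (throw α t) = throw (ρ α) (cren ρ t)

-- weakening of continuation variables (used to express α ∉ FCV(v)
-- for the bound variable α = 0 of a catch)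
wkC : Tm → Tm
wkC = cren suc

exts : (ℕ → Tm) → ℕ → Tm
exts σ zero    = var zero
exts σ (suc n) = ren suc (σ n)

sub : (ℕ → Tm) → Tm → Tm
sub σ (var x)     = σ x
sub σ unit        = unit
sub σ nil         = nil
sub σ cons        = cons
sub σ lrec        = lrec
sub σ (lam t)     = lam (sub (exts σ) t)
sub σ (app t s)   = app (sub σ t) (sub σ s)
sub σ (catch t)   = catch (sub (λ n → wkC (σ n)) t)
sub σ (throw α t) = throw α (sub σ t)

single : Tm → ℕ → Tm
single v zero    = v
single v (suc n) = var n

_[_] : Tm → Tm → Tm
t [ v ] = sub (single v) t

_∷ₜ_ : Tm → Tm → Tm
t ∷ₜ r = app (app cons t) r

data Value : Tm → Set where
  v-var   : ∀ x → Value (var x)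
  v-unit  : Value unit
  v-nil   : Value nil
  v-cons0 : Value cons
  v-cons1 : ∀ {v} → Value v → Value (app cons v)
  v-cons2 : ∀ {v w} → Value v → Value w → Value (app (app cons v) w)
  v-lrec0 : Value lrec
  v-lrec1 : ∀ {v} → Value v → Value (app lrec v)
  v-lrec2 : ∀ {v w} → Value v → Value w → Value (app (app lrec v) w)
  v-lam   : ∀ r → Value (lam r)

infix 4 _⟶_
data _⟶_ : Tm → Tm → Set where
  β-lam      : ∀ {t v} → Value v → app (lam t) v ⟶ t [ v ]
  -- E[throw α t] → throw α t,  E ::= □ t | v □ | throw β □
  thr-appL   : ∀ {α t s} → app (throw α t) s ⟶ throw α t
  thr-appR   : ∀ {v α t} → Value v → app v (throw α t) ⟶ throw α t
  thr-thr    : ∀ {β α t} → throw β (throw α t) ⟶ throw α t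
  catch-thr  : ∀ {t} → catch (throw zero t) ⟶ catch t
  -- catch α (throw β v) → throw β v   if α ∉ {β} ∪ FCV(v)
  catch-thr' : ∀ {β v} → Value v → catch (throw (suc β) (wkC v)) ⟶ throw β v
  -- catch α v → v   if α ∉ FCV(v)
  catch-val  : ∀ {v} → Value v → catch (wkC v) ⟶ v
  lrec-nil   : ∀ {vr vs} → Value vr → Value vs →
               app (app (app lrec vr) vs) nil ⟶ vr
  lrec-cons  : ∀ {vr vs vh vt} → Value vr → Value vs → Value vh → Value vt →
               app (app (app lrec vr) vs) (vh ∷ₜ vt)
                 ⟶ app (app (app vs vh) vt) (app (app (app lrec vr) vs) vt)
  ξ-lam      : ∀ {t t'} → t ⟶ t' → lam t ⟶ lam t'
  ξ-appL     : ∀ {t t' s} → t ⟶ t' → app t s ⟶ app t' s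
  ξ-appR     : ∀ {t s s'} → s ⟶ s' → app t s ⟶ app t s'
  ξ-catch    : ∀ {t t'} → t ⟶ t' → catch t ⟶ catch t'
  ξ-throw    : ∀ {α t t'} → t ⟶ t' → throw α t ⟶ throw α t'

infix 4 _↠_
data _↠_ : Tm → Tm → Set where
  ↠-refl : ∀ {t} → t ↠ t
  ↠-step : ∀ {t u r} → t ⟶ u → u ↠ r → t ↠ r

data Steps : ℕ → Tm → Tm → Set where
  st-zero : ∀ {t} → Steps zero t t
  st-suc  : ∀ {n t u r} → t ⟶ u → Steps n u r → Steps (suc n) t r

SN : Tm → Set
SN t = Σ ℕ λ b → ∀ n u → Steps n t u → n ≤ b

data L (S : Tm → Set) (t : Tm) : Set where
  mkL : (∀ v w → Value v → Value w → t ↠ (v ∷ₜ w) → S v × L S w) → L S t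

⟦_⟧ : Ty → Tm → Set
⟦ unit ⟧     t = SN t
⟦ list σ ⟧   t = SN t × L ⟦ σ ⟧ t
⟦ σ ⇒ τ ⟧    t = ∀ s → ⟦ σ ⟧ s → ⟦ τ ⟧ (app t s)

-- For list σ, an element of L⟦σ⟧ is built
-- by recursion on the reduction bound of t: every step towards a value v ∷ w
-- lowers the bound, and once t is v ∷ w its head and tail inherit the bound,
-- since their reductions are reductions of v ∷ w. The head then lies in ⟦σ⟧
-- by induction, and the tail, a proper subterm, is handled by the same recursion.
module Submission where

open import Defs
open import Data.Nat using (ℕ; zero; suc; _≤_; s≤s)
open import Data.Product using (_×_; _,_)

Bounded : ℕ → Tm → Set
Bounded b t = ∀ n u → Steps n t u → n ≤ b

Steps-map : ∀ (F : Tm → Tm) → (∀ {a c} → a ⟶ c → F a ⟶ F c) →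
            ∀ {n a c} → Steps n a c → Steps n (F a) (F c)
Steps-map F F-step st-zero         = st-zero
Steps-map F F-step (st-suc s rest) = st-suc (F-step s) (Steps-map F F-step rest)

Bounded-⟶ : ∀ {b t u} → Bounded (suc b) t → t ⟶ u → Bounded b u
Bounded-⟶ B s n u′ steps with B (suc n) u′ (st-suc s steps)
... | s≤s n≤b = n≤b

Bounded-head : ∀ {b v w} → Bounded b (v ∷ₜ w) → Bounded b v
Bounded-head {w = w} B n u steps =
  B n _ (Steps-map (λ x → x ∷ₜ w) (λ s → ξ-appL (ξ-appR s)) steps)

Bounded-tail : ∀ {b v w} → Bounded b (v ∷ₜ w) → Bounded b w
Bounded-tail {v = v} B n u steps =
  B n _ (Steps-map (v ∷ₜ_) ξ-appR steps)

module _ {S : Tm → Set} (SN⊆S : ∀ t → SN t → S t) where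
  mutual
    Bounded⇒L : ∀ b t → Bounded b t → L S t
    Bounded⇒L b t B = mkL λ v w _ _ t↠v∷w → ↠-cons-components b t B t↠v∷w

    ↠-cons-components : ∀ b t → Bounded b t → ∀ {v w} → t ↠ (v ∷ₜ w) → S v × L S w
    ↠-cons-components b (app (app cons v) w) B ↠-refl =
      SN⊆S v (b , Bounded-head B) , Bounded⇒L b w (Bounded-tail B)
    ↠-cons-components zero    t B (↠-step s _) with B 1 _ (st-suc s st-zero)
    ... | ()
    ↠-cons-components (suc b) t B (↠-step s rest) =
      ↠-cons-components b _ (Bounded-⟶ B s) rest

  SN⊆L : ∀ t → SN t → L S t
  SN⊆L t (b , B) = Bounded⇒L b t B

lemma4p5 : ∀ (ψ : Ty) → ArrowFree ψ → ∀ (t : Tm) → SN t → ⟦ ψ ⟧ t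
lemma4p5 unit     af-unit        t sn = sn
lemma4p5 (list τ) (af-list τ-af) t sn = sn , SN⊆L (lemma4p5 τ τ-af) t sn
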